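{- Let $N\ge 0$, $g\ge1$ and $B\ge1$ be integers, and let $g'=\lfloor N/B\rfloor$. The number of ordered partitions of $N$ into $g$ parts, where every part is an integer in $[0,B]$ (i.e., the number of tuples $(a_1,\dots,a_g)$ of integers with $0\le a_i\le B$ and $\sum_i a_i=N$), is at least $\binom{N-2g'+g-1}{g-g'-1}$.
   Context: Binomial coefficients $\binom{a}{b}$ are taken to be $0$ when $b<0$ or $b>a$. -}

module Defs where

open import Data.Nat using (ℕ; zero; suc; _+_; _∸_; _≤_; _<_; _≟_; _≤?_; _/_; NonZero)
open import Data.Nat.Combinatorics using (_C_)
open import Data.Integer as ℤ using (ℤ; +_; -[1+_])
open import Data.List using (List; []; _∷_; map; length; filter; upTo; concatMap)
open import Data.Vec using (Vec; []; _∷_; sum)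
open import Relation.Nullary.Decidable using (does)

boundedTuples : (B g : ℕ) → List (Vec ℕ g)
boundedTuples B zero    = [] ∷ []
boundedTuples B (suc g) =
  concatMap (λ a → map (a ∷_) (boundedTuples B g)) (upTo (suc B))

boundedCompositions : (N g B : ℕ) → ℕ
boundedCompositions N g B =
  length (filter (λ v → sum v ≟ N) (boundedTuples B g))

-- Integer binomial coefficient with the convention binom a b = 0
-- when b < 0 or b > a (in particular whenever a < 0 ≤ b).
binomℤ : ℤ → ℤ → ℕ
binomℤ (+ a)     (+ b)     = a C b
binomℤ (+ a)     -[1+ _ ]  = 0
binomℤ -[1+ _ ]  _         = 0

-- Write N = r + qB with 0 ≤ r < B and g = q + G + 1; the bound then reads
-- C(r + q(B-1) + G, G), and for q ≥ g its lower index is negative.  Let f(N, g)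
-- count the tuples.  Conditioning on the first part gives
-- f(N, g+1) ≥ Σ_{a ≤ t} f(N - a, g) for t ≤ min(B, N), and with c = q(B-1) + G
-- the hockey-stick identity
--   C(r + c + 1, G + 1) = Σ_{a ≤ r} C(r + c - a, G) + C(c, G + 1)
-- splits the binomial the same way.  A first part a ≤ r keeps the quotient q,
-- so those terms are bounded by induction on G; the remainder C(c, G + 1) is
-- paid for by the first part r + 1 ≤ B, which leaves (q-1)B + (B-1) to the
-- other parts, by induction on q (for q = 0 the remainder vanishes).
module Submission where

open import Defs
open import Data.Nat
  using (ℕ; zero; suc; _+_; _*_; _∸_; _≤_; _<_; z≤n; s≤s; s≤s⁻¹; _≟_; _≤?_; _/_; NonZero)
open import Data.Integer as ℤ using (ℤ; +_)
open import Data.Nat.Properties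
open import Data.Nat.DivMod using (_%_; m≡m%n+[m/n]*n; m%n<n)
open import Data.Nat.Combinatorics using (_C_; nCk+nC[k+1]≡[n+1]C[k+1]; k>n⇒nCk≡0)
open import Data.Nat.ListAction as List using ()
open import Data.Nat.ListAction.Properties using (sum-++)
open import Data.List using (List; []; _∷_; [_]; _++_; concat; map; length; filter; upTo)
open import Data.List.Properties using (filter-++; filter-≐; length-++; map-++; map-∘; upTo-∷ʳ)
open import Data.Vec as Vec using (Vec)
open import Data.Bool using (true; false)
open import Data.Product using (_,_)
open import Data.Sum using (inj₁; inj₂)
open import Function using (_∘_)
open import Level using (0ℓ)
open import Relation.Nullary.Decidable using (Dec; does; yes; no)
open import Relation.Unary using (Pred; Decidable)
open import Relation.Binary.PropositionalEquality
  using (_≡_; refl; sym; trans; cong; cong₂; subst₂; module ≡-Reasoning)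
open import Data.Integer.Properties using (pos-*)
open import Data.Integer.Tactic.RingSolver using (solve-∀)

sumBelow : (ℕ → ℕ) → ℕ → ℕ
sumBelow h zero    = 0
sumBelow h (suc n) = sumBelow h n + h n

sum-map-upTo : ∀ h n → List.sum (map h (upTo n)) ≡ sumBelow h n
sum-map-upTo h zero    = refl
sum-map-upTo h (suc n) = begin
  List.sum (map h (upTo (suc n)))       ≡⟨ cong (List.sum ∘ map h) (upTo-∷ʳ n) ⟨
  List.sum (map h (upTo n ++ [ n ]))    ≡⟨ cong List.sum (map-++ h (upTo n) [ n ]) ⟩
  List.sum (map h (upTo n) ++ [ h n ])  ≡⟨ sum-++ (map h (upTo n)) [ h n ] ⟩
  List.sum (map h (upTo n)) + (h n + 0) ≡⟨ cong₂ _+_ (sum-map-upTo h n) (+-identityʳ (h n)) ⟩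
  sumBelow h n + h n                    ∎
  where open ≡-Reasoning

sumBelow-mono-≤ : ∀ {h k} n → (∀ {a} → a < n → h a ≤ k a) → sumBelow h n ≤ sumBelow k n
sumBelow-mono-≤ zero    h≤k = ≤-refl
sumBelow-mono-≤ (suc n) h≤k = +-mono-≤ (sumBelow-mono-≤ n (h≤k ∘ m<n⇒m<1+n)) (h≤k ≤-refl)

sumBelow-monoʳ-≤ : ∀ h {m n} → m ≤ n → sumBelow h m ≤ sumBelow h n
sumBelow-monoʳ-≤ h {m} {zero}  z≤n = ≤-refl
sumBelow-monoʳ-≤ h {m} {suc n} m≤1+n with m≤n⇒m<n∨m≡n m≤1+n
... | inj₁ (s≤s m≤n) = ≤-trans (sumBelow-monoʳ-≤ h m≤n) (m≤m+n (sumBelow h n) (h n))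
... | inj₂ refl      = ≤-refl

nCk≤[1+n]Ck : ∀ n k → n C k ≤ suc n C k
nCk≤[1+n]Ck n zero    = ≤-refl
nCk≤[1+n]Ck n (suc k) = ≤-trans (m≤n+m (n C suc k) (n C k)) (≤-reflexive (nCk+nC[k+1]≡[n+1]C[k+1] n k))

hockey-stick : ∀ j c k → suc (j + c) C suc k ≡ sumBelow (λ a → (j + c ∸ a) C k) (suc j) + c C suc k
hockey-stick zero    c k = sym (nCk+nC[k+1]≡[n+1]C[k+1] c k)
hockey-stick (suc j) c k = begin
  suc (suc j + c) C suc k                                      ≡⟨ cong (λ n → suc n C suc k) (+-suc j c) ⟨
  suc (j + suc c) C suc k                                      ≡⟨ hockey-stick j (suc c) k ⟩
  sumBelow (λ a → (j + suc c ∸ a) C k) (suc j) + suc c C suc k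
    ≡⟨ cong₂ _+_ (cong (λ n → sumBelow (λ a → (n ∸ a) C k) (suc j)) (+-suc j c))
                 (sym (nCk+nC[k+1]≡[n+1]C[k+1] c k)) ⟩
  sumBelow h (suc j) + (c C k + c C suc k)
    ≡⟨ +-assoc (sumBelow h (suc j)) (c C k) (c C suc k) ⟨
  sumBelow h (suc j) + c C k + c C suc k
    ≡⟨ cong (λ n → sumBelow h (suc j) + n C k + c C suc k) (m+n∸m≡n (suc j) c) ⟨
  sumBelow h (suc (suc j)) + c C suc k                         ∎
  where
  open ≡-Reasoning
  h : ℕ → ℕ
  h a = (suc j + c ∸ a) C k

module _ {A : Set} {P : Pred A 0ℓ} (P? : Decidable P) where

  length-filter-concat : ∀ xss → length (filter P? (concat xss)) ≡ List.sum (map (length ∘ filter P?) xss)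
  length-filter-concat []         = refl
  length-filter-concat (xs ∷ xss) = begin
    length (filter P? (xs ++ concat xss))             ≡⟨ cong length (filter-++ P? xs (concat xss)) ⟩
    length (filter P? xs ++ filter P? (concat xss))   ≡⟨ length-++ (filter P? xs) ⟩
    length (filter P? xs) + length (filter P? (concat xss))
      ≡⟨ cong (_+_ (length (filter P? xs))) (length-filter-concat xss) ⟩
    length (filter P? xs) + List.sum (map (length ∘ filter P?) xss) ∎
    where open ≡-Reasoning

  length-filter-map : ∀ {B : Set} (h : B → A) xs →
    length (filter P? (map h xs)) ≡ length (filter (P? ∘ h) xs)
  length-filter-map h []       = refl
  length-filter-map h (x ∷ xs) with does (P? (h x))
  ... | true  = cong suc (length-filter-map h xs)
  ... | false = length-filter-map h xs

module _ (B : ℕ) where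

  private
    firstPartCount : ℕ → ℕ → ℕ → ℕ
    firstPartCount N g a = length (filter (λ v → Vec.sum v ≟ N) (map (a Vec.∷_) (boundedTuples B g)))

  boundedCompositions-suc : ∀ N g → boundedCompositions N (suc g) B ≡ sumBelow (firstPartCount N g) (suc B)
  boundedCompositions-suc N g = begin
    length (filter P? (concat (map F (upTo (suc B)))))      ≡⟨ length-filter-concat P? (map F (upTo (suc B))) ⟩
    List.sum (map (length ∘ filter P?) (map F (upTo (suc B)))) ≡⟨ cong List.sum (map-∘ (upTo (suc B))) ⟨
    List.sum (map (firstPartCount N g) (upTo (suc B)))      ≡⟨ sum-map-upTo (firstPartCount N g) (suc B) ⟩
    sumBelow (firstPartCount N g) (suc B)                   ∎
    where
    open ≡-Reasoning
    P? : (v : Vec ℕ (suc g)) → Dec (Vec.sum v ≡ N)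
    P? v = Vec.sum v ≟ N
    F : ℕ → List (Vec ℕ (suc g))
    F a = map (a Vec.∷_) (boundedTuples B g)

  firstPartCount≡ : ∀ {N a} g → a ≤ N → firstPartCount N g a ≡ boundedCompositions (N ∸ a) g B
  firstPartCount≡ {N} {a} g a≤N = trans (length-filter-map _ (a Vec.∷_) (boundedTuples B g))
    (cong length (filter-≐ _ _ (to , from) (boundedTuples B g)))
    where
    to : ∀ {s} → a + s ≡ N → s ≡ N ∸ a
    to {s} refl = sym (m+n∸m≡n a s)
    from : ∀ {s} → s ≡ N ∸ a → a + s ≡ N
    from refl = m+[n∸m]≡n a≤N

  sumBelow-boundedCompositions-≤ : ∀ {N t} g → t ≤ suc B → t ≤ suc N →
    sumBelow (λ a → boundedCompositions (N ∸ a) g B) t ≤ boundedCompositions N (suc g) B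
  sumBelow-boundedCompositions-≤ {N} {t} g t≤1+B t≤1+N = begin
    sumBelow (λ a → boundedCompositions (N ∸ a) g B) t
      ≤⟨ sumBelow-mono-≤ t (λ a<t → ≤-reflexive (sym (firstPartCount≡ g (s≤s⁻¹ (≤-trans a<t t≤1+N))))) ⟩
    sumBelow (firstPartCount N g) t       ≤⟨ sumBelow-monoʳ-≤ (firstPartCount N g) t≤1+B ⟩
    sumBelow (firstPartCount N g) (suc B) ≡⟨ boundedCompositions-suc N g ⟨
    boundedCompositions N (suc g) B       ∎
    where open ≤-Reasoning

  boundedCompositions-step : ∀ {N a} g → a ≤ B → a ≤ N →
    boundedCompositions (N ∸ a) g B ≤ boundedCompositions N (suc g) B
  boundedCompositions-step {N} {a} g a≤B a≤N =
    ≤-trans (m≤n+m _ (sumBelow (λ b → boundedCompositions (N ∸ b) g B) a))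
            (sumBelow-boundedCompositions-≤ g (s≤s a≤B) (s≤s a≤N))

m+[1+n]∸[1+m]≡n : ∀ m n → m + suc n ∸ suc m ≡ n
m+[1+n]∸[1+m]≡n m n = trans (cong (_∸ suc m) (+-suc m n)) (m+n∸m≡n m n)

module _ {B' : ℕ} where

  private
    B : ℕ
    B = suc B'

  hockey-stick-≤ : ∀ q G {r} → r < B →
    (∀ {s} → s < B → (s + (q * B' + G)) C G ≤ boundedCompositions (s + q * B) (suc (q + G)) B) →
    (r + (q * B' + suc G)) C suc G
      ≤ sumBelow (λ a → boundedCompositions (r + q * B ∸ a) (suc (q + G)) B) (suc r)
        + (q * B' + G) C suc G
  hockey-stick-≤ q G {r} r<B bound = begin
    (r + (q * B' + suc G)) C suc G
      ≡⟨ cong (_C suc G) (trans (cong (_+_ r) (+-suc (q * B') G)) (+-suc r c)) ⟩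
    suc (r + c) C suc G             ≡⟨ hockey-stick r c G ⟩
    sumBelow (λ a → (r + c ∸ a) C G) (suc r) + c C suc G
      ≤⟨ +-monoˡ-≤ (c C suc G) (sumBelow-mono-≤ (suc r) termwise) ⟩
    sumBelow (λ a → boundedCompositions (N ∸ a) (suc (q + G)) B) (suc r) + c C suc G ∎
    where
    open ≤-Reasoning
    c N : ℕ
    c = q * B' + G
    N = r + q * B
    termwise : ∀ {a} → a < suc r → (r + c ∸ a) C G ≤ boundedCompositions (N ∸ a) (suc (q + G)) B
    termwise {a} a<1+r = subst₂ _≤_
      (cong (_C G) (sym (+-∸-comm c (s≤s⁻¹ a<1+r))))
      (cong (λ n → boundedCompositions n (suc (q + G)) B) (sym (+-∸-comm (q * B) (s≤s⁻¹ a<1+r))))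
      (bound (≤-<-trans (m∸n≤m r a) r<B))

  m<m+[1+n]*B : ∀ m n → m < m + suc n * B
  m<m+[1+n]*B m n = ≤-trans (s≤s (m≤m+n m _)) (≤-reflexive (sym (+-suc m _)))

  binomial≤boundedCompositions : ∀ q G {r} → r < B →
    (r + (q * B' + G)) C G ≤ boundedCompositions (r + q * B) (suc (q + G)) B
  binomial≤boundedCompositions zero zero {r} r<B = begin
    1                                          ≡⟨ cong (λ n → boundedCompositions n 0 B) (n∸n≡0 (r + 0)) ⟨
    boundedCompositions (r + 0 ∸ (r + 0)) 0 B  ≤⟨ boundedCompositions-step B 0 r+0≤B ≤-refl ⟩
    boundedCompositions (r + 0) 1 B            ∎
    where
    open ≤-Reasoning
    r+0≤B : r + 0 ≤ B
    r+0≤B = ≤-trans (≤-reflexive (+-identityʳ r)) (<⇒≤ r<B)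
  binomial≤boundedCompositions (suc q) zero {r} r<B = begin
    1
      ≤⟨ binomial≤boundedCompositions q zero ≤-refl ⟩
    boundedCompositions (B' + q * B) (suc (q + 0)) B
      ≡⟨ cong (λ n → boundedCompositions n (suc (q + 0)) B) (m+[1+n]∸[1+m]≡n r _) ⟨
    boundedCompositions (r + suc q * B ∸ suc r) (suc (q + 0)) B
      ≤⟨ boundedCompositions-step B (suc (q + 0)) r<B (m<m+[1+n]*B r q) ⟩
    boundedCompositions (r + suc q * B) (suc (suc q + 0)) B
      ∎
    where open ≤-Reasoning
  binomial≤boundedCompositions zero (suc G) {r} r<B = begin
    (r + suc G) C suc G
      ≤⟨ hockey-stick-≤ zero G r<B (binomial≤boundedCompositions zero G) ⟩
    sumBelow h (suc r) + G C suc G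
      ≡⟨ cong (_+_ (sumBelow h (suc r))) (k>n⇒nCk≡0 (n<1+n G)) ⟩
    sumBelow h (suc r) + 0
      ≡⟨ +-identityʳ (sumBelow h (suc r)) ⟩
    sumBelow h (suc r)
      ≤⟨ sumBelow-boundedCompositions-≤ B (suc G) (m≤n⇒m≤1+n r<B) (s≤s (m≤m+n r 0)) ⟩
    boundedCompositions (r + 0) (suc (suc G)) B
      ∎
    where
    open ≤-Reasoning
    h : ℕ → ℕ
    h a = boundedCompositions (r + 0 ∸ a) (suc G) B
  binomial≤boundedCompositions (suc q) (suc G) {r} r<B = begin
    (r + (suc q * B' + suc G)) C suc G
      ≤⟨ hockey-stick-≤ (suc q) G r<B (binomial≤boundedCompositions (suc q) G) ⟩
    sumBelow h (suc r) + (suc q * B' + G) C suc G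
      ≤⟨ +-monoʳ-≤ (sumBelow h (suc r)) remainder ⟩
    sumBelow h (suc (suc r))
      ≤⟨ sumBelow-boundedCompositions-≤ B g (s≤s r<B) (s≤s (m<m+[1+n]*B r q)) ⟩
    boundedCompositions N (suc g) B
      ≡⟨ cong (λ n → boundedCompositions N (suc (suc n)) B) (+-suc q G) ⟨
    boundedCompositions N (suc (suc q + suc G)) B
      ∎
    where
    open ≤-Reasoning
    N g : ℕ
    N = r + suc q * B
    g = suc (suc q + G)
    h : ℕ → ℕ
    h a = boundedCompositions (N ∸ a) g B
    shuffle : suc (B' + q * B' + G) ≡ B' + (q * B' + suc G)
    shuffle = sym (trans (cong (_+_ B') (+-suc (q * B') G))
                         (trans (+-suc B' _) (cong suc (sym (+-assoc B' _ G)))))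
    remainder : (suc q * B' + G) C suc G ≤ h (suc r)
    remainder = begin
      (suc q * B' + G) C suc G         ≤⟨ nCk≤[1+n]Ck _ (suc G) ⟩
      suc (B' + q * B' + G) C suc G    ≡⟨ cong (_C suc G) shuffle ⟩
      (B' + (q * B' + suc G)) C suc G  ≤⟨ binomial≤boundedCompositions q (suc G) ≤-refl ⟩
      boundedCompositions (B' + q * B) (suc (q + suc G)) B
        ≡⟨ cong₂ (λ n k → boundedCompositions n (suc k) B) (sym (m+[1+n]∸[1+m]≡n r _)) (+-suc q G) ⟩
      h (suc r)                        ∎

binomℤ-negative : ∀ x {y} d → y ≡ ℤ.-[1+ d ] → binomℤ x y ≡ 0
binomℤ-negative (+ a)      d refl = refl
binomℤ-negative ℤ.-[1+ a ] d refl = refl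

upper-index : ∀ {N} r q G B' → N ≡ r + q * suc B' →
  (+ N) ℤ.- (+ 2) ℤ.* (+ q) ℤ.+ (+ suc (q + G)) ℤ.- (+ 1) ≡ + (r + (q * B' + G))
upper-index r q G B' refl = begin
  (+ r ℤ.+ + (q * suc B')) ℤ.- + 2 ℤ.* + q ℤ.+ (+ 1 ℤ.+ (+ q ℤ.+ + G)) ℤ.- + 1
    ≡⟨ cong (λ z → (+ r ℤ.+ z) ℤ.- + 2 ℤ.* + q ℤ.+ (+ 1 ℤ.+ (+ q ℤ.+ + G)) ℤ.- + 1) (pos-* q (suc B')) ⟩
  (+ r ℤ.+ + q ℤ.* (+ 1 ℤ.+ + B')) ℤ.- + 2 ℤ.* + q ℤ.+ (+ 1 ℤ.+ (+ q ℤ.+ + G)) ℤ.- + 1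
    ≡⟨ identity (+ r) (+ q) (+ B') (+ G) ⟩
  + r ℤ.+ (+ q ℤ.* + B' ℤ.+ + G)
    ≡⟨ cong (λ z → + r ℤ.+ (z ℤ.+ + G)) (pos-* q B') ⟨
  + r ℤ.+ (+ (q * B') ℤ.+ + G) ∎
  where
  open ≡-Reasoning
  identity : ∀ r q b G →
    (r ℤ.+ q ℤ.* (+ 1 ℤ.+ b)) ℤ.- + 2 ℤ.* q ℤ.+ (+ 1 ℤ.+ (q ℤ.+ G)) ℤ.- + 1 ≡ r ℤ.+ (q ℤ.* b ℤ.+ G)
  identity = solve-∀

lower-index : ∀ q G → (+ suc (q + G)) ℤ.- (+ q) ℤ.- (+ 1) ≡ + G
lower-index q G = identity (+ q) (+ G)
  where
  identity : ∀ q G → (+ 1 ℤ.+ (q ℤ.+ G)) ℤ.- q ℤ.- + 1 ≡ G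
  identity = solve-∀

lower-index-negative : ∀ {q} g d → g + d ≡ q → (+ g) ℤ.- (+ q) ℤ.- (+ 1) ≡ ℤ.-[1+ d ]
lower-index-negative g d refl = trans (identity (+ g) (+ d)) (-[n]-1 d)
  where
  identity : ∀ g d → g ℤ.- (g ℤ.+ d) ℤ.- + 1 ≡ ℤ.- d ℤ.- + 1
  identity = solve-∀
  -[n]-1 : ∀ d → ℤ.- (+ d) ℤ.- + 1 ≡ ℤ.-[1+ d ]
  -[n]-1 zero    = refl
  -[n]-1 (suc d) = cong (λ n → ℤ.-[1+ suc n ]) (+-identityʳ d)

lemma9 : (N g B : ℕ) → 1 ≤ g → (hB : 1 ≤ B) → .{{_ : NonZero B}} →
    binomℤ ((+ N) ℤ.- (+ 2) ℤ.* (+ (N / B)) ℤ.+ (+ g) ℤ.- (+ 1))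
           ((+ g) ℤ.- (+ (N / B)) ℤ.- (+ 1))
      ≤ boundedCompositions N g B
lemma9 N (suc g') (suc B') _ _ with N / suc B' ≤? g'
... | yes q≤g' with G , refl ← m≤n⇒∃[o]m+o≡n q≤g' =
  subst₂ _≤_ (sym (cong₂ binomℤ (upper-index (N % suc B') q G B' hN) (lower-index q G)))
             (cong (λ n → boundedCompositions n (suc (q + G)) (suc B')) (sym hN))
             (binomial≤boundedCompositions q G (m%n<n N (suc B')))
  where
  q : ℕ
  q = N / suc B'
  hN : N ≡ N % suc B' + q * suc B'
  hN = m≡m%n+[m/n]*n N (suc B')
... | no q≰g' with d , g+d≡q ← m≤n⇒∃[o]m+o≡n (≰⇒> q≰g') =
  ≤-trans (≤-reflexive (binomℤ-negative upper d (lower-index-negative (suc g') d g+d≡q))) z≤n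
  where
  upper : ℤ
  upper = (+ N) ℤ.- (+ 2) ℤ.* (+ (N / suc B')) ℤ.+ (+ suc g') ℤ.- (+ 1)
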